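{- For an ideal $\mathcal{I}$ on $\omega$, the following are equivalent: (1) Player I does not have a winning strategy in the tallness* game with respect to $\mathcal{I}$; (2) for every sequence $\langle X_n : n < \omega\rangle$ of sets in $\mathcal{I}^+$ there is $I \in \mathcal{I}$ such that $I \cap X_n$ is infinite for every $n \in \omega$.
   Context: As usual, ideals on $\omega$ are assumed to contain all finite subsets of $\omega$ and not to contain $\omega$; $\mathcal{I}^+ = \mathcal{P}(\omega)\setminus\mathcal{I}$. The tallness* game with respect to $\mathcal{I}$: in round $k$ Player I plays $n_k \in \omega$, subject to $n_0 < n_1 < \cdots$, then Player II plays $i_k \in \{0,1\}$; Player II wins iff either ($\{n_k : k\in\omega\} \in \mathcal{I}^+$ and $\{n_k : k \in\omega, i_k = 1\}$ is an infinite member of $\mathcal{I}$) or $\{n_k : k \in \omega\} \in \mathcal{I}$; otherwise Player I wins. -}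

module Defs where

open import Level using (0ℓ)
open import Data.Nat using (ℕ; zero; suc; _<_; _≤_)
open import Data.Bool using (Bool; true; false)
open import Data.List using (List; []; _∷_; map; upTo)
open import Data.Product using (Σ; ∃; ∃-syntax; _×_; _,_)
open import Data.Sum using (_⊎_)
open import Relation.Nullary using (¬_)
open import Relation.Unary using (Pred; _∈_; _∉_; _⊆_; _∪_; _∩_; U)
open import Relation.Binary.PropositionalEquality using (_≡_)

Subset : Set₁
Subset = Pred ℕ 0ℓ

Finite : Subset → Set
Finite X = ∃[ m ] (∀ n → n ∈ X → n < m)

Infinite : Subset → Set
Infinite X = ∀ m → ∃[ n ] (m ≤ n × n ∈ X)

Family : Set₁
Family = Subset → Set

record IsIdeal (𝓘 : Family) : Set₁ where
  field
    downward : ∀ {A B : Subset} → A ⊆ B → 𝓘 B → 𝓘 A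
    union    : ∀ {A B : Subset} → 𝓘 A → 𝓘 B → 𝓘 (A ∪ B)
    finite   : ∀ (A : Subset) → Finite A → 𝓘 A
    proper   : ¬ 𝓘 U

Positive : Family → Subset → Set
Positive 𝓘 X = ¬ 𝓘 X

-- A strategy for Player I: given Player II's previous moves
-- i_0, …, i_{k-1} (as a list, in order), return n_k.
StrategyI : Set
StrategyI = List Bool → ℕ

history : (ℕ → Bool) → ℕ → List Bool
history y k = map y (upTo k)

moveI : StrategyI → (ℕ → Bool) → ℕ → ℕ
moveI σ y k = σ (history y k)

playedSet : StrategyI → (ℕ → Bool) → Subset
playedSet σ y n = ∃[ k ] (moveI σ y k ≡ n)

chosenSet : StrategyI → (ℕ → Bool) → Subset
chosenSet σ y n = ∃[ k ] (moveI σ y k ≡ n × y k ≡ true)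

IIWins : Family → StrategyI → (ℕ → Bool) → Set
IIWins 𝓘 σ y =
  (Positive 𝓘 (playedSet σ y) × (Infinite (chosenSet σ y) × 𝓘 (chosenSet σ y)))
  ⊎ 𝓘 (playedSet σ y)

WinningI : Family → StrategyI → Set
WinningI 𝓘 σ = ∀ (y : ℕ → Bool) →
  (∀ k → moveI σ y k < moveI σ y (suc k)) × ¬ IIWins 𝓘 σ y

-- (2) ⇒ (1): let σ be a strategy for Player I. Every finite history s of Player II,
-- continued by zeros, yields a play of σ; if σ is winning, its set of moves is
-- 𝓘-positive, so (2) gives I ∈ 𝓘 meeting all of these countably many sets
-- infinitely. Player II answers n_k with 1 iff n_k ∈ I. If II said 1 only finitely
-- often, the play would be one of the zero-continued plays above, hence would meet I
-- infinitely often, so II would have said 1 infinitely often after all. So the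
-- chosen set is an infinite subset of I and II wins.
--
-- (1) ⇒ (2): given positive sets X_n, Player I plays greedily: with c ones played by
-- II so far, the next move is the least element of X_{t(c)} above the previous
-- move, where t hits every index infinitely often. Since this σ is not winning, some
-- play is won by II. If II said 1 infinitely often, every value of the counter c is
-- attained at a move answered by 1, so the chosen set, which is in 𝓘, meets every
-- X_n infinitely. If II said 1 only finitely often, c is eventually constant and
-- the play enumerates a tail of the positive set X_{t(c)}; then neither winning
-- condition for II can hold.
module Submission where

open import Defs
open import Level using (0ℓ)
open import Axiom.ExcludedMiddle using (ExcludedMiddle)
open import Data.Bool using (Bool; true; false; if_then_else_)
open import Data.Empty using (⊥-elim)
open import Data.List using (List; []; _∷_; _∷ʳ_; _++_; foldl; map; upTo; applyUpTo; length; replicate)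
open import Data.List.Properties using (map-cong; map-upTo; foldl-∷ʳ; applyUpTo-∷ʳ; length-++; length-replicate)
open import Data.Nat using (ℕ; zero; suc; _+_; _≤_; _<_; _≤?_; z≤n; s≤s; _≤′_; ≤′-reflexive; ≤′-step)
open import Data.Nat.Binary.Base as Bin using (ℕᵇ; 2[1+_]; 1+[2_])
open import Data.Nat.Binary.Properties using (fromℕ-toℕ)
open import Data.Nat.Induction using (<-rec)
open import Data.Nat.Properties
open import Data.Product using (∃-syntax; _×_; _,_; proj₁; proj₂)
open import Data.Sum using (_⊎_; inj₁; inj₂)
open import Function using (_∘_)
open import Function.Bundles using (_⇔_; mk⇔)
open import Relation.Nullary using (¬_; Dec; yes; no; does)
open import Relation.Nullary.Decidable using (decidable-stable; dec-true)
open import Relation.Unary using (_∩_; _∪_; _⊆_)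
open import Relation.Binary.PropositionalEquality
  using (_≡_; _≗_; refl; sym; trans; cong; subst; module ≡-Reasoning)

infinite-⊆ : ∀ {X Y : Subset} → X ⊆ Y → Infinite X → Infinite Y
infinite-⊆ X⊆Y inf m with inf m
... | n , m≤n , x = n , m≤n , X⊆Y x

infinite⇒¬finite : ∀ {X : Subset} → Infinite X → ¬ Finite X
infinite⇒¬finite inf (m , bounded) with inf m
... | n , m≤n , x = <⇒≱ (bounded n x) m≤n

infinite⊎finite : ExcludedMiddle 0ℓ → (X : Subset) → Infinite X ⊎ Finite X
infinite⊎finite em X with em {Finite X}
... | yes fin = inj₂ fin
... | no ¬fin = inj₁ λ m → decidable-stable em λ ¬above →
  ¬fin (m , λ n x → ≰⇒> λ m≤n → ¬above (n , m≤n , x))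

least : ExcludedMiddle 0ℓ → {P : Subset} → ∀ x → P x → ∃[ m ] (P m × (∀ {w} → w < m → ¬ P w))
least em {P} = <-rec Goal search
  where
  Goal : ℕ → Set
  Goal x = P x → ∃[ m ] (P m × (∀ {w} → w < m → ¬ P w))

  search : ∀ x → (∀ {v} → v < x → Goal v) → Goal x
  search x rec px with em {∃[ w ] (w < x × P w)}
  ... | yes (w , w<x , pw) = rec w<x pw
  ... | no none = x , px , λ w<x pw → none (_ , w<x , pw)

least-above : ExcludedMiddle 0ℓ → {X : Subset} → Infinite X →
  ∀ a → ∃[ x ] (a ≤ x × X x × (∀ {w} → a ≤ w → w < x → ¬ X w))
least-above em {X} inf a with inf a
... | n , a≤n , xn with least em {λ w → a ≤ w × X w} n (a≤n , xn)
... | x , (a≤x , xx) , minimal = x , a≤x , xx , λ a≤w w<x xw → minimal w<x (a≤w , xw)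

positive⇒infinite : ExcludedMiddle 0ℓ → ∀ {𝓘 X} → IsIdeal 𝓘 → Positive 𝓘 X → Infinite X
positive⇒infinite em {X = X} isI pos with infinite⊎finite em X
... | inj₁ inf = inf
... | inj₂ fin = ⊥-elim (pos (IsIdeal.finite isI X fin))

Increasing : (ℕ → ℕ) → Set
Increasing f = ∀ k → f k < f (suc k)

module _ {f : ℕ → ℕ} (inc : Increasing f) where

  increasing-mono-≤ : ∀ {j k} → j ≤ k → f j ≤ f k
  increasing-mono-≤ = go ∘ ≤⇒≤′
    where
    go : ∀ {j k} → j ≤′ k → f j ≤ f k
    go (≤′-reflexive refl) = ≤-refl
    go (≤′-step j≤′k) = ≤-trans (go j≤′k) (<⇒≤ (inc _))

  increasing-cancel-≤ : ∀ {j k} → f j ≤ f k → j ≤ k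
  increasing-cancel-≤ fj≤fk =
    ≮⇒≥ λ k<j → <⇒≱ (<-≤-trans (inc _) (increasing-mono-≤ k<j)) fj≤fk

  increasing⇒≥id : ∀ k → k ≤ f k
  increasing⇒≥id zero = z≤n
  increasing⇒≥id (suc k) = ≤-<-trans (increasing⇒≥id k) (inc k)

  increasing-covers : ∀ {X : Subset} {M} →
    (∀ {k w} → M ≤ k → f k < w → w < f (suc k) → ¬ X w) →
    ∀ {x} → X x → f M ≤ x → ∃[ k ] (f k ≡ x)
  increasing-covers {X} {M} gap {x} xx fM≤x =
    below x (≤-trans (m≤m+n x M) (increasing⇒≥id (x + M)))
    where
    below : ∀ d → x ≤ f (d + M) → ∃[ k ] (f k ≡ x)
    below zero x≤fM = M , ≤-antisym fM≤x x≤fM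
    below (suc d) x≤f with x ≤? f (d + M)
    ... | yes x≤f′ = below d x≤f′
    ... | no x≰f′ with m≤n⇒m<n∨m≡n x≤f
    ...   | inj₂ x≡f = suc (d + M) , sym x≡f
    ...   | inj₁ x<f = ⊥-elim (gap (m≤n+m M d) (≰⇒> x≰f′) x<f xx)

-- ℕᵇ is bijective base 2, so digit strings of numerals are exactly the lists of booleans.
toBits : ℕᵇ → List Bool
toBits Bin.zero = []
toBits 2[1+ x ] = true ∷ toBits x
toBits 1+[2 x ] = false ∷ toBits x

fromBits : List Bool → ℕᵇ
fromBits [] = Bin.zero
fromBits (true ∷ s) = 2[1+ fromBits s ]
fromBits (false ∷ s) = 1+[2 fromBits s ]

toBits-fromBits : ∀ s → toBits (fromBits s) ≡ s
toBits-fromBits [] = refl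
toBits-fromBits (true ∷ s) = cong (true ∷_) (toBits-fromBits s)
toBits-fromBits (false ∷ s) = cong (false ∷_) (toBits-fromBits s)

decode : ℕ → List Bool
decode = toBits ∘ Bin.fromℕ

encode : List Bool → ℕ
encode = Bin.toℕ ∘ fromBits

decode-encode : ∀ s → decode (encode s) ≡ s
decode-encode s = trans (cong toBits (fromℕ-toℕ (fromBits s))) (toBits-fromBits s)

length≤encode : ∀ s → length s ≤ encode s
length≤encode [] = z≤n
length≤encode (true ∷ s) = ≤-trans (s≤s (length≤encode s)) (m≤m+n _ _)
length≤encode (false ∷ s) = s≤s (≤-trans (length≤encode s) (m≤m+n _ _))

leadingTrues : List Bool → ℕ
leadingTrues (true ∷ s) = suc (leadingTrues s)
leadingTrues _ = zero

leadingTrues-replicate : ∀ n s → leadingTrues (replicate n true ++ false ∷ s) ≡ n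
leadingTrues-replicate zero s = refl
leadingTrues-replicate (suc n) s = cong suc (leadingTrues-replicate n s)

schedule : ℕ → ℕ
schedule = leadingTrues ∘ decode

schedule-infinite : ∀ n → Infinite (λ q → schedule q ≡ n)
schedule-infinite n B =
  encode s , ≤-trans B≤length (length≤encode s) ,
  trans (cong leadingTrues (decode-encode s)) (leadingTrues-replicate n padding)
  where
  padding = replicate B false
  s = replicate n true ++ false ∷ padding

  B≤length : B ≤ length s
  B≤length = begin
    B                                        ≡⟨ length-replicate B ⟨
    length padding                           ≤⟨ n≤1+n _ ⟩
    length (false ∷ padding)                 ≤⟨ m≤n+m _ _ ⟩
    length (replicate n true) + length (false ∷ padding) ≡⟨ length-++ (replicate n true) ⟨
    length s                                 ∎
    where open ≤-Reasoning

Ones : (ℕ → Bool) → Subset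
Ones y k = y k ≡ true

history-suc : ∀ y k → history y (suc k) ≡ history y k ∷ʳ y k
history-suc y k = begin
  map y (upTo (suc k))      ≡⟨ map-upTo y (suc k) ⟩
  applyUpTo y (suc k)       ≡⟨ applyUpTo-∷ʳ y k ⟨
  applyUpTo y k ∷ʳ y k      ≡⟨ cong (_∷ʳ y k) (map-upTo y k) ⟨
  map y (upTo k) ∷ʳ y k     ∎
  where open ≡-Reasoning

foldl-history : ∀ {A : Set} (f : A → Bool → A) e y k →
  foldl f e (history y (suc k)) ≡ f (foldl f e (history y k)) (y k)
foldl-history f e y k =
  trans (cong (foldl f e) (history-suc y k)) (foldl-∷ʳ f e (y k) (history y k))

moveI-cong : ∀ σ {y z} → y ≗ z → ∀ k → moveI σ y k ≡ moveI σ z k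
moveI-cong σ y≗z k = cong σ (map-cong y≗z (upTo k))

module _ {σ : StrategyI} {y : ℕ → Bool} (legal : Increasing (moveI σ y)) where

  ones-infinite⇒chosen-infinite : Infinite (Ones y) → Infinite (chosenSet σ y)
  ones-infinite⇒chosen-infinite ones m with ones m
  ... | k , m≤k , yk = moveI σ y k , ≤-trans m≤k (increasing⇒≥id legal k) , k , refl , yk

  chosen-infinite⇒ones-infinite : Infinite (chosenSet σ y) → Infinite (Ones y)
  chosen-infinite⇒ones-infinite chosen m with chosen (moveI σ y m)
  ... | n , mm≤n , k , mk≡n , yk =
    k , increasing-cancel-≤ legal (subst (moveI σ y m ≤_) (sym mk≡n) mm≤n) , yk

IIWins⇒chosen∈𝓘 : ∀ {𝓘 σ y} → IsIdeal 𝓘 → IIWins 𝓘 σ y → 𝓘 (chosenSet σ y)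
IIWins⇒chosen∈𝓘 isI (inj₁ (_ , _ , chosen∈𝓘)) = chosen∈𝓘
IIWins⇒chosen∈𝓘 isI (inj₂ played∈𝓘) = IsIdeal.downward isI (λ (k , eq , _) → k , eq) played∈𝓘

responseHistory : StrategyI → (ℕ → Bool) → ℕ → List Bool
responseHistory σ b zero = []
responseHistory σ b (suc k) = responseHistory σ b k ∷ʳ b (σ (responseHistory σ b k))

respond : StrategyI → (ℕ → Bool) → ℕ → Bool
respond σ b k = b (σ (responseHistory σ b k))

history-respond : ∀ σ b k → history (respond σ b) k ≡ responseHistory σ b k
history-respond σ b zero = refl
history-respond σ b (suc k) =
  trans (history-suc (respond σ b) k) (cong (_∷ʳ respond σ b k) (history-respond σ b k))

respond-spec : ∀ σ b k → respond σ b k ≡ b (moveI σ (respond σ b) k)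
respond-spec σ b k = cong (b ∘ σ) (sym (history-respond σ b k))

padFalse : List Bool → ℕ → Bool
padFalse [] _ = false
padFalse (b ∷ _) zero = b
padFalse (_ ∷ s) (suc i) = padFalse s i

padFalse-history : ∀ y M → (∀ k → Ones y k → k < M) → padFalse (history y M) ≗ y
padFalse-history y M bounded i = trans (cong (λ s → padFalse s i) (map-upTo y M)) (go y M bounded i)
  where
  go : ∀ y M → (∀ k → Ones y k → k < M) → padFalse (applyUpTo y M) ≗ y
  go y zero bounded i with y i in eq
  ... | false = refl
  ... | true = ⊥-elim (n≮0 (bounded i eq))
  go y (suc M) bounded zero = refl
  go y (suc M) bounded (suc i) = go (y ∘ suc) M (λ k yk → ≤-pred (bounded (suc k) yk)) i

finite-ones⇒padded : ∀ y → Finite (Ones y) → ∃[ e ] (padFalse (decode e) ≗ y)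
finite-ones⇒padded y (M , bounded) = encode (history y M) , λ i →
  trans (cong (λ s → padFalse s i) (decode-encode (history y M))) (padFalse-history y M bounded i)

tick : Bool → ℕ → ℕ
tick b c = if b then suc c else c

countTrue : (ℕ → Bool) → ℕ → ℕ
countTrue y zero = zero
countTrue y (suc k) = tick (y k) (countTrue y k)

countTrue-stable : ∀ {y m k} → m ≤′ k → (∀ {j} → m ≤ j → j < k → ¬ Ones y j) →
  countTrue y k ≡ countTrue y m
countTrue-stable (≤′-reflexive refl) _ = refl
countTrue-stable {y} {k = suc k} (≤′-step m≤′k) none with y k in eq
... | true = ⊥-elim (none (≤′⇒≤ m≤′k) ≤-refl eq)
... | false = countTrue-stable m≤′k (λ m≤j j<k → none m≤j (m<n⇒m<1+n j<k))

module _ (em : ExcludedMiddle 0ℓ) {y : ℕ → Bool} (ones : Infinite (Ones y)) where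

  first-one : ∀ m → ∃[ k ] (m ≤ k × Ones y k × countTrue y k ≡ countTrue y m)
  first-one m with least-above em ones m
  ... | k , m≤k , yk , before = k , m≤k , yk , countTrue-stable (≤⇒≤′ m≤k) before

  one-at-every-count : ∀ m q → countTrue y m ≤ q → ∃[ k ] (m ≤ k × Ones y k × countTrue y k ≡ q)
  one-at-every-count m zero c≤0 with first-one m
  ... | k , m≤k , yk , ck≡cm = k , m≤k , yk , trans ck≡cm (n≤0⇒n≡0 c≤0)
  one-at-every-count m (suc q) c≤q with m≤n⇒m<n∨m≡n c≤q
  ... | inj₂ cm≡q with first-one m
  ...   | k , m≤k , yk , ck≡cm = k , m≤k , yk , trans ck≡cm cm≡q
  one-at-every-count m (suc q) c≤q | inj₁ c<q with one-at-every-count m q (≤-pred c<q)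
  ... | k , m≤k , yk , ck≡q with first-one (suc k)
  ...   | k′ , k<k′ , yk′ , ck′≡csk =
    k′ , ≤-trans m≤k (<⇒≤ k<k′) , yk′ ,
    trans ck′≡csk (trans (cong (λ b → tick b (countTrue y k)) yk) (cong suc ck≡q))

MeetsPositiveSequences : Family → Set₁
MeetsPositiveSequences 𝓘 = ∀ (X : ℕ → Subset) → (∀ n → Positive 𝓘 (X n)) →
  ∃[ I ] (𝓘 I × (∀ n → Infinite (I ∩ X n)))

dec-true⁻¹ : ∀ {A : Set} (a? : Dec A) → does a? ≡ true → A
dec-true⁻¹ (yes a) _ = a

module _ (em : ExcludedMiddle 0ℓ) {𝓘 : Family} (isI : IsIdeal 𝓘) where
  open IsIdeal isI

  meets⇒¬winningI : MeetsPositiveSequences 𝓘 → ¬ (∃[ σ ] WinningI 𝓘 σ)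
  meets⇒¬winningI meets (σ , win) = proj₂ (win y) II-wins
    where
    paddedPlay : ℕ → ℕ → Bool
    paddedPlay e = padFalse (decode e)

    paddedPlay-positive : ∀ e → Positive 𝓘 (playedSet σ (paddedPlay e))
    paddedPlay-positive e played∈𝓘 = proj₂ (win (paddedPlay e)) (inj₂ played∈𝓘)

    I = proj₁ (meets _ paddedPlay-positive)
    I∈𝓘 = proj₁ (proj₂ (meets _ paddedPlay-positive))
    I-meets = proj₂ (proj₂ (meets _ paddedPlay-positive))

    answer : ℕ → Bool
    answer n = does (em {I n})

    y : ℕ → Bool
    y = respond σ answer

    chosen⊆I : chosenSet σ y ⊆ I
    chosen⊆I (k , mk≡n , yk) =
      subst I mk≡n (dec-true⁻¹ (em {I (moveI σ y k)}) (trans (sym (respond-spec σ answer k)) yk))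

    played∩I⊆chosen : playedSet σ y ∩ I ⊆ chosenSet σ y
    played∩I⊆chosen ((k , mk≡n) , n∈I) =
      k , mk≡n , trans (respond-spec σ answer k) (dec-true (em {I (moveI σ y k)}) (subst I (sym mk≡n) n∈I))

    chosen-infinite : Infinite (chosenSet σ y)
    chosen-infinite with infinite⊎finite em (Ones y)
    ... | inj₁ ones = ones-infinite⇒chosen-infinite {σ} {y} (proj₁ (win y)) ones
    ... | inj₂ fin with finite-ones⇒padded y fin
    ...   | e , padded≗y = infinite-⊆ I∩padded⊆chosen (I-meets e)
      where
      I∩padded⊆chosen : I ∩ playedSet σ (paddedPlay e) ⊆ chosenSet σ y
      I∩padded⊆chosen (n∈I , k , mk≡n) =
        played∩I⊆chosen ((k , trans (moveI-cong σ (sym ∘ padded≗y) k) mk≡n) , n∈I)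

    II-wins : IIWins 𝓘 σ y
    II-wins with em {𝓘 (playedSet σ y)}
    ... | yes played∈𝓘 = inj₂ played∈𝓘
    ... | no played∉𝓘 = inj₁ (played∉𝓘 , chosen-infinite , downward chosen⊆I I∈𝓘)

  module GreedyStrategy (X : ℕ → Subset) (pos : ∀ n → Positive 𝓘 (X n)) where

    next-spec : ∀ n a → ∃[ x ] (a ≤ x × X n x × (∀ {w} → a ≤ w → w < x → ¬ X n w))
    next-spec n = least-above em (positive⇒infinite em isI (pos n))

    next : ℕ → ℕ → ℕ
    next n a = proj₁ (next-spec n a)

    next-≥ : ∀ n a → a ≤ next n a
    next-≥ n a = proj₁ (proj₂ (next-spec n a))

    next-∈ : ∀ n a → X n (next n a)
    next-∈ n a = proj₁ (proj₂ (proj₂ (next-spec n a)))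

    next-least : ∀ n a {w} → a ≤ w → w < next n a → ¬ X n w
    next-least n a = proj₂ (proj₂ (proj₂ (next-spec n a)))

    -- The state is the last move together with the number of ones answered so far.
    step : ℕ × ℕ → Bool → ℕ × ℕ
    step (m , c) b = next (schedule (tick b c)) (suc m) , tick b c

    start : ℕ × ℕ
    start = next (schedule 0) 0 , 0

    σ : StrategyI
    σ s = proj₁ (foldl step start s)

    module _ (y : ℕ → Bool) where

      count-state : ∀ k → proj₂ (foldl step start (history y k)) ≡ countTrue y k
      count-state zero = refl
      count-state (suc k) = trans (cong proj₂ (foldl-history step start y k)) (cong (tick (y k)) (count-state k))

      move-suc : ∀ k → moveI σ y (suc k) ≡ next (schedule (countTrue y (suc k))) (suc (moveI σ y k))
      move-suc k = trans (cong proj₁ (foldl-history step start y k))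
        (cong (λ c → next (schedule (tick (y k) c)) (suc (moveI σ y k))) (count-state k))

      move-∈ : ∀ k → X (schedule (countTrue y k)) (moveI σ y k)
      move-∈ zero = next-∈ (schedule 0) 0
      move-∈ (suc k) = subst (X _) (sym (move-suc k)) (next-∈ _ _)

      legal : Increasing (moveI σ y)
      legal k = subst (moveI σ y k <_) (sym (move-suc k)) (next-≥ _ _)

      ones-infinite⇒meets : Infinite (Ones y) → ∀ n → Infinite (chosenSet σ y ∩ X n)
      ones-infinite⇒meets ones n m with schedule-infinite n (countTrue y m)
      ... | q , cm≤q , tq≡n with one-at-every-count em ones m q cm≤q
      ... | k , m≤k , yk , ck≡q =
        moveI σ y k , ≤-trans m≤k (increasing⇒≥id legal k) , (k , refl , yk) ,
        subst (λ i → X i (moveI σ y k)) (trans (cong schedule ck≡q) tq≡n) (move-∈ k)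

      ones-finite⇒¬IIWins : Finite (Ones y) → ¬ IIWins 𝓘 σ y
      ones-finite⇒¬IIWins fin (inj₁ (_ , chosen-inf , _)) =
        infinite⇒¬finite (chosen-infinite⇒ones-infinite {σ} {y} legal chosen-inf) fin
      ones-finite⇒¬IIWins (M , bounded) (inj₂ played∈𝓘) =
        pos (schedule (countTrue y M)) (downward tail⊆played (union (finite _ (moveI σ y M , λ _ x<m → x<m)) played∈𝓘))
        where
        count-constant : ∀ {k} → M ≤ k → countTrue y k ≡ countTrue y M
        count-constant M≤k = countTrue-stable (≤⇒≤′ M≤k) λ M≤j _ yj → <⇒≱ (bounded _ yj) M≤j

        gap : ∀ {k w} → M ≤ k → moveI σ y k < w → w < moveI σ y (suc k) → ¬ X (schedule (countTrue y M)) w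
        gap {k} M≤k mk<w w<msk xw =
          next-least _ _ mk<w (subst (_ <_) (move-suc k) w<msk)
            (subst (λ c → X (schedule c) _) (sym (count-constant (≤-trans M≤k (n≤1+n k)))) xw)

        tail⊆played : X (schedule (countTrue y M)) ⊆ (λ x → x < moveI σ y M) ∪ playedSet σ y
        tail⊆played {x} xx with moveI σ y M ≤? x
        ... | yes mM≤x = inj₂ (increasing-covers legal gap xx mM≤x)
        ... | no mM≰x = inj₁ (≰⇒> mM≰x)

    won⇒meets : ∃[ y ] IIWins 𝓘 σ y → ∃[ I ] (𝓘 I × (∀ n → Infinite (I ∩ X n)))
    won⇒meets (y , wins) with infinite⊎finite em (Ones y)
    ... | inj₁ ones = chosenSet σ y , IIWins⇒chosen∈𝓘 {𝓘} {σ} {y} isI wins , ones-infinite⇒meets y ones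
    ... | inj₂ fin = ⊥-elim (ones-finite⇒¬IIWins y fin wins)

  ¬winningI⇒meets : ¬ (∃[ σ ] WinningI 𝓘 σ) → MeetsPositiveSequences 𝓘
  ¬winningI⇒meets ¬winning X pos =
    won⇒meets (decidable-stable em λ ¬won → ¬winning (σ , λ y → legal y , λ wins → ¬won (y , wins)))
    where open GreedyStrategy X pos

theorem6p8 : ExcludedMiddle 0ℓ → (𝓘 : Family) → IsIdeal 𝓘 →
    (¬ (∃[ σ ] WinningI 𝓘 σ))
      ⇔ (∀ (X : ℕ → Subset) → (∀ n → Positive 𝓘 (X n)) →
           ∃[ I ] (𝓘 I × (∀ n → Infinite (I ∩ X n))))
theorem6p8 em 𝓘 isI = mk⇔ (¬winningI⇒meets em isI) (meets⇒¬winningI em isI)
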